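{- Let $G=(V,E)$ and $G'=(V',E')$ be finite simple graphs. Then $\overline{X}_G=\overline{X}_{G'}$ if and only if the multiset $\{I_{G|_W}(t): W\subseteq V\}$ equals the multiset $\{I_{G'|_{W'}}(t): W'\subseteq V'\}$. In other words, knowing $\overline{X}_G$ is equivalent to knowing the multiset of independence polynomials of the induced subgraphs of $G$.
   Context: A proper set coloring of $G$ is a map $\kappa$ from $V$ to nonempty subsets of $\mathbb{Z}_{>0}$ with $\kappa(u)\cap\kappa(v)=\varnothing$ whenever $uv\in E$; the Kromatic symmetric function is $\overline{X}_G(x_1,x_2,\dots)=\sum_{\kappa}\prod_{v\in V}\prod_{i\in\kappa(v)}x_i$. For $W\subseteq V$, $G|_W$ is the induced subgraph on $W$ (including $W=\varnothing$), and $I_{H}(t)=\sum_{n\ge0}a_n t^n$ is the independence polynomial of a graph $H$, where $a_n$ is the number of independent sets of size $n$ in $H$. -}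

module Defs where

open import Data.Nat using (ℕ; zero; suc; _≡ᵇ_)
open import Data.Bool using (Bool; true; false; _∧_; _∨_; not; if_then_else_)
open import Data.Fin using (Fin)
open import Data.Fin.Subset using (Subset; ∣_∣)
open import Data.Vec using (Vec; []; _∷_; lookup)
open import Data.List using (List; []; _∷_; [_]; concatMap; map; allFin)
open import Data.Nat.ListAction using (sum)
open import Data.Bool.ListAction using (all; any)
open import Data.Product using (Σ)
open import Function.Bundles using (_↔_; Inverse)
open import Relation.Binary.PropositionalEquality using (_≡_)

record SimpleGraph (n : ℕ) : Set where
  field
    adj    : Fin n → Fin n → Bool
    sym    : ∀ u v → adj u v ≡ adj v u
    irrefl : ∀ v → adj v v ≡ false
open SimpleGraph public

allVecs : {A : Set} → List A → (n : ℕ) → List (Vec A n)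
allVecs xs zero = [ [] ]
allVecs xs (suc n) = concatMap (λ v → map (λ x → x ∷ v) xs) (allVecs xs n)

allSubsets : (n : ℕ) → List (Subset n)
allSubsets n = allVecs (true ∷ false ∷ []) n

count : {A : Set} → (A → Bool) → List A → ℕ
count p xs = sum (map (λ x → if p x then 1 else 0) xs)

_∈ᵇ_ : {n : ℕ} → Fin n → Subset n → Bool
v ∈ᵇ S = lookup S v

_⊆ᵇ_ : {n : ℕ} → Subset n → Subset n → Bool
_⊆ᵇ_ {n} S W = all (λ v → not (v ∈ᵇ S) ∨ (v ∈ᵇ W)) (allFin n)

isIndependent : {n : ℕ} → SimpleGraph n → Subset n → Bool
isIndependent {n} G S =
  all (λ u → all (λ v → not ((u ∈ᵇ S) ∧ (v ∈ᵇ S) ∧ adj G u v)) (allFin n)) (allFin n)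

-- Coefficient sequence of the independence polynomial I_{G|_W}(t):
-- the m-th coefficient is the number of independent sets of size m of the
-- induced subgraph G|_W, i.e. subsets S ⊆ W independent in G with |S| = m.
indPolyInduced : {n : ℕ} → SimpleGraph n → Subset n → ℕ → ℕ
indPolyInduced {n} G W m =
  count (λ S → (S ⊆ᵇ W) ∧ isIndependent G S ∧ (∣ S ∣ ≡ᵇ m)) (allSubsets n)

-- Multiset equality {I_{G|_W} : W ⊆ V} = {I_{G'|_W'} : W' ⊆ V'}:
-- a bijection between the index sets matching the polynomials
-- (polynomials compared coefficientwise).
SameIndPolyMultiset : {n n' : ℕ} → SimpleGraph n → SimpleGraph n' → Set
SameIndPolyMultiset {n} {n'} G G' =
  Σ (Subset n ↔ Subset n') λ σ →
    ∀ (W : Subset n) (m : ℕ) → indPolyInduced G W m ≡ indPolyInduced G' (Inverse.to σ W) m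

isProperSetColoring : {n k : ℕ} → SimpleGraph n → Vec (Subset k) n → Bool
isProperSetColoring {n} {k} G κ =
  all (λ v → any (λ c → c ∈ᵇ lookup κ v) (allFin k)) (allFin n)
  ∧ all (λ u → all (λ v → not (adj G u v)
        ∨ all (λ c → not ((c ∈ᵇ lookup κ u) ∧ (c ∈ᵇ lookup κ v))) (allFin k))
      (allFin n)) (allFin n)

colorMultiplicity : {n k : ℕ} → Vec (Subset k) n → Fin k → ℕ
colorMultiplicity {n} κ c = count (λ v → c ∈ᵇ lookup κ v) (allFin n)

-- Coefficient of the monomial x_1^{α_1} ... x_k^{α_k} in the Kromatic
-- symmetric function of G: number of proper set colorings κ whose monomial
-- ∏_v ∏_{i∈κ(v)} x_i equals x^α (such κ only use colors 1..k).
kromaticCoeff : {n : ℕ} → SimpleGraph n → (k : ℕ) → Vec ℕ k → ℕ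
kromaticCoeff {n} G k α =
  count (λ κ → isProperSetColoring G κ
               ∧ all (λ c → colorMultiplicity κ c ≡ᵇ lookup α c) (allFin k))
        (allVecs (allSubsets k) n)

-- Equality of formal power series X̄_G = X̄_G': all monomial coefficients agree.
-- Every monomial of finite support is x^α for some k and α : Vec ℕ k.
KromaticEq : {n n' : ℕ} → SimpleGraph n → SimpleGraph n' → Set
KromaticEq G G' = ∀ (k : ℕ) (α : Vec ℕ k) → kromaticCoeff G k α ≡ kromaticCoeff G' k α

-- Write a set colouring as the tuple of its colour classes. The classes must be independent
-- sets of prescribed sizes covering V, and inclusion–exclusion on the covering condition gives
--   [x^α] X̄_G = Σ_{W ⊆ V} (−1)^{|V|+|W|} ∏_c [t^{α_c}] I_{G|W}(t).
-- Since [t] I_{G|W} = |W|, the multiset of the I_{G|W} also determines |V|, so it determines X̄_G.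
-- Conversely, record each W as the point of ℕ^D formed by the coefficients of I_{G|W}, with weight
-- (−1)^{|V|+|W|}. Equal Kromatic functions make every monomial moment of the difference of the two
-- signed point measures vanish, and a product of affine forms vanishing at all points but one shows
-- that such a measure is zero. Because |W| is a coordinate of the point, the multiplicities of each
-- point then agree up to a global sign, which is positive because the point of W = ∅ occurs.

module Submission where

open import Algebra.Bundles using (CommutativeMonoid)
open import Data.Bool using (Bool; true; false; _∧_; _∨_; not; if_then_else_; T)
import Data.Bool.Properties as Bool
open import Algebra.Properties.CommutativeSemigroup (CommutativeMonoid.commutativeSemigroup Bool.∧-commutativeMonoid)
  using () renaming (interchange to ∧-interchange)
open import Data.Bool.ListAction using (all; any; and; or)
open import Data.Empty using (⊥-elim)
open import Data.Fin using (Fin; zero; suc; toℕ; fromℕ<)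
import Data.Fin.Properties as Fin
open import Data.Fin.Subset using (Subset; ∣_∣; ⊤; ⊥)
open import Data.Fin.Subset.Properties using (∣p∣≤n; ∣⊤∣≡n)
open import Data.Integer as ℤ using (ℤ; +_; 0ℤ; 1ℤ; -1ℤ; _+_; _*_; -_; _-_)
import Data.Integer.Properties as ℤ
open import Data.Integer.Solver using (module +-*-Solver)
open import Data.List using (List; []; _∷_; _++_; map; concatMap; allFin)
open import Data.List.Properties using (map-tabulate; map-cong)
open import Data.List.Membership.Propositional using (_∈_)
open import Data.List.Membership.Propositional.Properties using (∈-map⁺; ∈-map⁻; ∈-concat⁺′; map-∈↔; ∈-∃++)
open import Data.List.Membership.Propositional.Properties.WithK using (unique⇒irrelevant; unique∧set⇒bag)
open import Data.List.Relation.Unary.Any using (here; there)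
import Data.List.Relation.Unary.All as All
import Data.List.Relation.Unary.All.Properties as All
import Data.List.Relation.Unary.AllPairs as AllPairs
import Data.List.Relation.Unary.AllPairs.Properties as AllPairs
open import Data.List.Relation.Unary.Unique.Propositional using (Unique)
import Data.List.Relation.Unary.Unique.Propositional.Properties as Unique
open import Data.List.Relation.Binary.BagAndSetEquality using (∼bag⇒↭; ↭⇒∼bag)
open import Data.List.Relation.Binary.Permutation.Propositional as ↭ using (_↭_; prep; swap; ↭-trans; ↭-sym)
open import Data.List.Relation.Binary.Permutation.Propositional.Properties using (shift)
open import Data.Nat as ℕ using (ℕ; zero; suc; _≡ᵇ_; _≤_; _<_; z≤n; s≤s)
import Data.Nat.ListAction as ℕ
import Data.Nat.Properties as ℕ
open import Data.Product using (Σ; ∃; _×_; _,_; proj₁; proj₂)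
import Data.Product.Function.Dependent.Propositional as Σ
open import Data.Sum using (_⊎_; inj₁; inj₂; [_,_]′)
open import Data.Vec as Vec using (Vec; []; _∷_; lookup; tabulate)
open import Data.Vec.Properties
  using (lookup∘tabulate; tabulate∘lookup; tabulate-cong; lookup-map; ∷-injectiveˡ; ∷-injectiveʳ; ≡-dec)
open import Function using (_∘_; id; _↔_; _⇔_; Inverse; Injection; mk↔ₛ′; mk⇔)
open import Function.Construct.Symmetry using (↔-sym)
open import Function.Properties.Inverse using (↔⇒↣)
import Function.Related.Propositional as Related
open import Relation.Binary.Definitions using (DecidableEquality)
open import Relation.Binary.PropositionalEquality
open import Relation.Nullary using (¬_; Dec; yes; no)
open import Relation.Nullary.Decidable using (⌊_⌋)

open import Defs hiding (sym)
open +-*-Solver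

∑ : {A : Set} → List A → (A → ℤ) → ℤ
∑ []       f = 0ℤ
∑ (x ∷ xs) f = f x + ∑ xs f

syntax ∑ xs (λ x → e) = ∑[ x ∈ xs ] e

module _ {A : Set} where

  ∑-cong : (xs : List A) {f g : A → ℤ} → (∀ x → f x ≡ g x) → ∑ xs f ≡ ∑ xs g
  ∑-cong []       f≗g = refl
  ∑-cong (x ∷ xs) f≗g = cong₂ _+_ (f≗g x) (∑-cong xs f≗g)

  ∑-++ : (xs ys : List A) (f : A → ℤ) → ∑ (xs ++ ys) f ≡ ∑ xs f + ∑ ys f
  ∑-++ []       ys f = sym (ℤ.+-identityˡ _)
  ∑-++ (x ∷ xs) ys f = trans (cong (_+_ (f x)) (∑-++ xs ys f)) (sym (ℤ.+-assoc (f x) _ _))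

  ∑-zero : (xs : List A) → ∑[ x ∈ xs ] 0ℤ ≡ 0ℤ
  ∑-zero []       = refl
  ∑-zero (x ∷ xs) = trans (ℤ.+-identityˡ _) (∑-zero xs)

  ∑-distrib-+ : (xs : List A) (f g : A → ℤ) → ∑[ x ∈ xs ] (f x + g x) ≡ ∑ xs f + ∑ xs g
  ∑-distrib-+ []       f g = refl
  ∑-distrib-+ (x ∷ xs) f g rewrite ∑-distrib-+ xs f g =
    solve 4 (λ a b c d → (a :+ b) :+ (c :+ d) := (a :+ c) :+ (b :+ d)) refl (f x) (g x) (∑ xs f) (∑ xs g)

  ∑-*ˡ : (xs : List A) (c : ℤ) (f : A → ℤ) → ∑[ x ∈ xs ] (c * f x) ≡ c * ∑ xs f
  ∑-*ˡ []       c f = sym (ℤ.*-zeroʳ c)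
  ∑-*ˡ (x ∷ xs) c f = trans (cong (_+_ (c * f x)) (∑-*ˡ xs c f)) (sym (ℤ.*-distribˡ-+ c (f x) _))

  ∑-*ʳ : (xs : List A) (f : A → ℤ) (c : ℤ) → ∑[ x ∈ xs ] (f x * c) ≡ ∑ xs f * c
  ∑-*ʳ xs f c = begin
    ∑[ x ∈ xs ] (f x * c) ≡⟨ ∑-cong xs (λ x → ℤ.*-comm (f x) c) ⟩
    ∑[ x ∈ xs ] (c * f x) ≡⟨ ∑-*ˡ xs c f ⟩
    c * ∑ xs f            ≡⟨ ℤ.*-comm c _ ⟩
    ∑ xs f * c            ∎
    where open ≡-Reasoning

  ∑-neg : (xs : List A) (f : A → ℤ) → ∑[ x ∈ xs ] (- f x) ≡ - ∑ xs f
  ∑-neg []       f = refl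
  ∑-neg (x ∷ xs) f = trans (cong (_+_ (- f x)) (∑-neg xs f)) (sym (ℤ.neg-distrib-+ (f x) _))

  ∑-↭ : {xs ys : List A} (f : A → ℤ) → xs ↭ ys → ∑ xs f ≡ ∑ ys f
  ∑-↭ f ↭.refl                = refl
  ∑-↭ f (prep x p)            = cong (_+_ (f x)) (∑-↭ f p)
  ∑-↭ f (swap {ys = ys} x y p) rewrite ∑-↭ f p =
    solve 3 (λ a b c → a :+ (b :+ c) := b :+ (a :+ c)) refl (f x) (f y) (∑ ys f)
  ∑-↭ f (↭.trans p q)         = trans (∑-↭ f p) (∑-↭ f q)

∑-map : {A B : Set} (g : A → B) (xs : List A) (f : B → ℤ) → ∑ (map g xs) f ≡ ∑ xs (f ∘ g)
∑-map g []       f = refl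
∑-map g (x ∷ xs) f = cong (_+_ (f (g x))) (∑-map g xs f)

∑-concatMap : {A B : Set} (g : A → List B) (xs : List A) (f : B → ℤ) →
  ∑ (concatMap g xs) f ≡ ∑[ x ∈ xs ] ∑ (g x) f
∑-concatMap g []       f = refl
∑-concatMap g (x ∷ xs) f =
  trans (∑-++ (g x) (concatMap g xs) f) (cong (_+_ (∑ (g x) f)) (∑-concatMap g xs f))

∑-comm : {A B : Set} (xs : List A) (ys : List B) (f : A → B → ℤ) →
  ∑[ x ∈ xs ] ∑[ y ∈ ys ] f x y ≡ ∑[ y ∈ ys ] ∑[ x ∈ xs ] f x y
∑-comm []       ys f = sym (∑-zero ys)
∑-comm (x ∷ xs) ys f = trans (cong (_+_ (∑ ys (f x))) (∑-comm xs ys f)) (sym (∑-distrib-+ ys (f x) _))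

𝟙 : Bool → ℤ
𝟙 true  = 1ℤ
𝟙 false = 0ℤ

𝟙-∧ : ∀ a b → 𝟙 (a ∧ b) ≡ 𝟙 a * 𝟙 b
𝟙-∧ true  b = sym (ℤ.*-identityˡ (𝟙 b))
𝟙-∧ false b = refl

count≡∑𝟙 : {A : Set} (p : A → Bool) (xs : List A) → + count p xs ≡ ∑[ x ∈ xs ] 𝟙 (p x)
count≡∑𝟙 p []       = refl
count≡∑𝟙 p (x ∷ xs) with p x | count≡∑𝟙 p xs
... | true  | eq = trans (ℤ.pos-+ 1 _) (cong (_+_ 1ℤ) eq)
... | false | eq = trans eq (sym (ℤ.+-identityˡ _))

count-cong : {A : Set} (xs : List A) {p q : A → Bool} → (∀ x → p x ≡ q x) → count p xs ≡ count q xs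
count-cong xs p≗q = cong ℕ.sum (map-cong (λ x → cong (λ b → if b then 1 else 0) (p≗q x)) xs)

map-allFin-suc : {A : Set} {n : ℕ} (f : Fin (suc n) → A) →
  map f (allFin (suc n)) ≡ f zero ∷ map (f ∘ suc) (allFin n)
map-allFin-suc f = cong (f zero ∷_) (trans (map-tabulate suc f) (sym (map-tabulate id (f ∘ suc))))

all-allFin-suc : {n : ℕ} (p : Fin (suc n) → Bool) → all p (allFin (suc n)) ≡ p zero ∧ all (p ∘ suc) (allFin n)
all-allFin-suc p = cong and (map-allFin-suc p)

count-allFin-suc : {n : ℕ} (p : Fin (suc n) → Bool) →
  count p (allFin (suc n)) ≡ (if p zero then 1 else 0) ℕ.+ count (p ∘ suc) (allFin n)
count-allFin-suc p = cong ℕ.sum (map-allFin-suc (λ x → if p x then 1 else 0))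

module _ {A : Set} where

  all-cong : (xs : List A) {p q : A → Bool} → (∀ x → p x ≡ q x) → all p xs ≡ all q xs
  all-cong xs p≗q = cong and (map-cong p≗q xs)

  any-cong : (xs : List A) {p q : A → Bool} → (∀ x → p x ≡ q x) → any p xs ≡ any q xs
  any-cong xs p≗q = cong or (map-cong p≗q xs)

  all-true : (xs : List A) → all (λ _ → true) xs ≡ true
  all-true []       = refl
  all-true (x ∷ xs) = all-true xs

  all-∧ : (xs : List A) (p q : A → Bool) → all (λ x → p x ∧ q x) xs ≡ all p xs ∧ all q xs
  all-∧ []       p q = refl
  all-∧ (x ∷ xs) p q =
    trans (cong ((p x ∧ q x) ∧_) (all-∧ xs p q)) (∧-interchange (p x) (q x) (all p xs) (all q xs))

  ∨-all : (b : Bool) (xs : List A) (p : A → Bool) → b ∨ all p xs ≡ all (λ x → b ∨ p x) xs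
  ∨-all true  xs p = sym (all-true xs)
  ∨-all false xs p = refl

  all-not : (xs : List A) (p : A → Bool) → all (not ∘ p) xs ≡ not (any p xs)
  all-not []       p = refl
  all-not (x ∷ xs) p with p x
  ... | true  = refl
  ... | false = all-not xs p

  all-not-∨ : (xs : List A) (p : A → Bool) (b : Bool) → all (λ x → not (p x) ∨ b) xs ≡ not (any p xs) ∨ b
  all-not-∨ xs p true  =
    trans (all-cong xs (λ x → Bool.∨-zeroʳ (not (p x)))) (trans (all-true xs) (sym (Bool.∨-zeroʳ _)))
  all-not-∨ xs p false =
    trans (all-cong xs (λ x → Bool.∨-identityʳ (not (p x)))) (trans (all-not xs p) (sym (Bool.∨-identityʳ _)))

all-comm : {A B : Set} (xs : List A) (ys : List B) (f : A → B → Bool) →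
  all (λ x → all (f x) ys) xs ≡ all (λ y → all (λ x → f x y) xs) ys
all-comm []       ys f = sym (all-true ys)
all-comm (x ∷ xs) ys f = trans (cong (all (f x) ys ∧_) (all-comm xs ys f)) (sym (all-∧ ys (f x) _))

record IsEnumeration {A : Set} (xs : List A) : Set where
  field
    complete : ∀ a → a ∈ xs
    unique   : Unique xs
open IsEnumeration

booleans-isEnumeration : IsEnumeration (true ∷ false ∷ [])
booleans-isEnumeration .complete true  = here refl
booleans-isEnumeration .complete false = there (here refl)
booleans-isEnumeration .unique         = ((λ ()) All.∷ All.[]) AllPairs.∷ (All.[] AllPairs.∷ AllPairs.[])

allVecs-isEnumeration : {A : Set} {xs : List A} → IsEnumeration xs → (n : ℕ) → IsEnumeration (allVecs xs n)
allVecs-isEnumeration e zero .complete [] = here refl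
allVecs-isEnumeration e zero .unique      = All.[] AllPairs.∷ AllPairs.[]
allVecs-isEnumeration {xs = xs} e (suc n) .complete (x ∷ v) =
  ∈-concat⁺′ (∈-map⁺ (_∷ v) (complete e x)) (∈-map⁺ (λ w → map (_∷ w) xs) (complete (allVecs-isEnumeration e n) v))
allVecs-isEnumeration {xs = xs} e (suc n) .unique =
  Unique.concat⁺ (All.map⁺ (All.tabulate (λ _ → Unique.map⁺ ∷-injectiveˡ (unique e))))
                 (AllPairs.map⁺ (AllPairs.map disjoint (unique (allVecs-isEnumeration e n))))
  where
  disjoint : ∀ {v w} → ¬ v ≡ w → ∀ {u} → ¬ (u ∈ map (_∷ v) xs × u ∈ map (_∷ w) xs)
  disjoint v≢w (p , q) with ∈-map⁻ _ p | ∈-map⁻ _ q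
  ... | _ , _ , refl | _ , _ , eq = v≢w (∷-injectiveʳ eq)

allSubsets-isEnumeration : (n : ℕ) → IsEnumeration (allSubsets n)
allSubsets-isEnumeration = allVecs-isEnumeration booleans-isEnumeration

module _ {A B : Set} {xs : List A} {ys : List B} (exs : IsEnumeration xs) (eys : IsEnumeration ys) where

  ∑-reindex : (σ : A ↔ B) (f : B → ℤ) → ∑[ x ∈ xs ] f (Inverse.to σ x) ≡ ∑ ys f
  ∑-reindex σ f =
    trans (sym (∑-map to xs f)) (∑-↭ f (∼bag⇒↭ (unique∧set⇒bag unique-to (unique eys) same-elements)))
    where
    open Inverse σ
    unique-to : Unique (map to xs)
    unique-to = Unique.map⁺ (Injection.injective (↔⇒↣ σ)) (unique exs)
    same-elements : ∀ {y} → y ∈ map to xs ⇔ y ∈ ys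
    same-elements {y} = mk⇔ (λ _ → complete eys y)
      (λ _ → subst (_∈ map to xs) (strictlyInverseˡ y) (∈-map⁺ to (complete exs (from y))))

Fibre : {A P : Set} → (A → P) → List A → P → Set
Fibre f xs p = ∃ λ a → a ∈ xs × p ≡ f a

↔-Σ-Fibre : {A P : Set} {xs : List A} → IsEnumeration xs → (f : A → P) → A ↔ Σ P (Fibre f xs)
↔-Σ-Fibre {A} {P} {xs} e f = mk↔ₛ′ to from to∘from (λ _ → refl)
  where
  to : A → Σ P (Fibre f xs)
  to a = f a , a , complete e a , refl
  from : Σ P (Fibre f xs) → A
  from (_ , a , _) = a
  to∘from : ∀ q → to (from q) ≡ q
  to∘from (_ , a , a∈xs , refl) = cong (λ m → f a , a , m , refl) (unique⇒irrelevant (unique e) _ a∈xs)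

module _ {A B P : Set} {xs : List A} {ys : List B} (exs : IsEnumeration xs) (eys : IsEnumeration ys) where

  ↭-images⇒↔ : (f : A → P) (g : B → P) → map f xs ↭ map g ys →
    Σ (A ↔ B) λ σ → ∀ a → f a ≡ g (Inverse.to σ a)
  ↭-images⇒↔ f g f↭g = σ , fibre-equation
    where
    σ : A ↔ B
    σ = begin
      A                 ↔⟨ ↔-Σ-Fibre exs f ⟩
      Σ P (Fibre f xs)  ↔⟨ Σ.congˡ (map-∈↔ f) ⟩
      Σ P (_∈ map f xs) ↔⟨ Σ.congˡ (↭⇒∼bag f↭g) ⟩
      Σ P (_∈ map g ys) ↔⟨ Σ.congˡ (↔-sym (map-∈↔ g)) ⟩
      Σ P (Fibre g ys)  ↔⟨ ↔-sym (↔-Σ-Fibre eys g) ⟩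
      B                 ∎
      where open Related.EquationalReasoning {k = Related.bijection}
    -- σ a indexes the g-fibre that the bag equality assigns to f a; that fibre carries f a ≡ g (σ a).
    fibre-equation : ∀ a → f a ≡ g (Inverse.to σ a)
    fibre-equation a = proj₂ (proj₂ (Inverse.from (map-∈↔ g)
      (Inverse.to (↭⇒∼bag f↭g) (Inverse.to (map-∈↔ f) (a , complete exs a , refl)))))

count-↭ : {A : Set} (p : A → Bool) {xs ys : List A} → xs ↭ ys → count p xs ≡ count p ys
count-↭ p {xs} {ys} xs↭ys =
  ℤ.+-injective (trans (count≡∑𝟙 p xs) (trans (∑-↭ (𝟙 ∘ p) xs↭ys) (sym (count≡∑𝟙 p ys))))

module _ {P : Set} (_≟_ : DecidableEquality P) where

  multiplicity : P → List P → ℕ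
  multiplicity y = count (λ x → ⌊ x ≟ y ⌋)

  ∈⇒multiplicity>0 : ∀ {y xs} → y ∈ xs → 1 ≤ multiplicity y xs
  ∈⇒multiplicity>0 {y} {x ∷ xs} (here refl) with y ≟ y
  ... | yes _  = s≤s z≤n
  ... | no y≢y = ⊥-elim (y≢y refl)
  ∈⇒multiplicity>0 {y} {x ∷ xs} (there y∈xs) = ℕ.≤-trans (∈⇒multiplicity>0 y∈xs) (ℕ.m≤n+m _ _)

  multiplicity>0⇒∈ : ∀ {y} xs → 1 ≤ multiplicity y xs → y ∈ xs
  multiplicity>0⇒∈ {y} (x ∷ xs) pos with x ≟ y
  ... | yes refl = here refl
  ... | no _     = there (multiplicity>0⇒∈ xs pos)

  same-multiplicities⇒↭ : (xs ys : List P) → (∀ y → multiplicity y xs ≡ multiplicity y ys) → xs ↭ ys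
  same-multiplicities⇒↭ []       []       _ = ↭.refl
  same-multiplicities⇒↭ []       (y ∷ ys) same
    with subst (1 ≤_) (sym (same y)) (∈⇒multiplicity>0 {xs = y ∷ ys} (here refl))
  ... | ()
  same-multiplicities⇒↭ (x ∷ xs) ys       same
    with ∈-∃++ (multiplicity>0⇒∈ ys (subst (1 ≤_) (same x) (∈⇒multiplicity>0 {xs = x ∷ xs} (here refl))))
  ... | as , bs , refl = ↭-trans (prep x (same-multiplicities⇒↭ xs (as ++ bs) same-tail)) (↭-sym (shift x as bs))
    where
    same-tail : ∀ y → multiplicity y xs ≡ multiplicity y (as ++ bs)
    same-tail y = ℕ.+-cancelˡ-≡ (if ⌊ x ≟ y ⌋ then 1 else 0) _ _ (trans (same y) (count-↭ _ (shift x as bs)))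

-- Signs, products and inclusion–exclusion

-1^_ : ℕ → ℤ
-1^ zero  = 1ℤ
-1^ suc n = - (-1^ n)

-1^-+ : ∀ a b → -1^ (a ℕ.+ b) ≡ (-1^ a) * (-1^ b)
-1^-+ zero    b = sym (ℤ.*-identityˡ (-1^ b))
-1^-+ (suc a) b = trans (cong -_ (-1^-+ a b)) (ℤ.neg-distribˡ-* (-1^ a) (-1^ b))

-1^-+-suc : ∀ a b → -1^ (a ℕ.+ suc b) ≡ - (-1^ (a ℕ.+ b))
-1^-+-suc a b = cong -1^_ (ℕ.+-suc a b)

-1^≡±1 : ∀ a → -1^ a ≡ 1ℤ ⊎ -1^ a ≡ -1ℤ
-1^≡±1 zero = inj₁ refl
-1^≡±1 (suc a) with -1^≡±1 a
... | inj₁ eq = inj₂ (cong -_ eq)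
... | inj₂ eq = inj₁ (cong -_ eq)

-1^-*-cancelʳ : ∀ x y m → x * -1^ m ≡ y * -1^ m → x ≡ y
-1^-*-cancelʳ x y m eq with -1^ m | -1^≡±1 m
... | _ | inj₁ refl = ℤ.*-cancelʳ-≡ x y 1ℤ eq
... | _ | inj₂ refl = ℤ.*-cancelʳ-≡ x y -1ℤ eq

-1^-+-cong : ∀ a b m → -1^ (a ℕ.+ m) ≡ -1^ (b ℕ.+ m) → ∀ m′ → -1^ (a ℕ.+ m′) ≡ -1^ (b ℕ.+ m′)
-1^-+-cong a b m eq m′ rewrite -1^-+ a m′ | -1^-+ b m′ =
  cong (_* -1^ m′) (-1^-*-cancelʳ (-1^ a) (-1^ b) m (trans (sym (-1^-+ a m)) (trans eq (-1^-+ b m))))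

-1^-*-same-sign : ∀ a b c c′ → -1^ a * + c ≡ -1^ b * + c′ → 1 ≤ c → -1^ a ≡ -1^ b
-1^-*-same-sign a b c c′ eq 1≤c with -1^ a | -1^≡±1 a | -1^ b | -1^≡±1 b
... | _ | inj₁ refl | _ | inj₁ refl = refl
... | _ | inj₂ refl | _ | inj₂ refl = refl
... | _ | inj₁ refl | _ | inj₂ refl =
  ⊥-elim (pos≢neg c c′ 1≤c (trans (sym (ℤ.*-identityˡ (+ c))) (trans eq (ℤ.-1*i≡-i (+ c′)))))
  where
  pos≢neg : ∀ c c′ → 1 ≤ c → + c ≢ - + c′
  pos≢neg (suc c) zero    _ ()
  pos≢neg (suc c) (suc c′) _ ()
... | _ | inj₂ refl | _ | inj₁ refl =
  ⊥-elim (neg≢pos c c′ 1≤c (trans (sym (ℤ.-1*i≡-i (+ c))) (trans eq (ℤ.*-identityˡ (+ c′)))))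
  where
  neg≢pos : ∀ c c′ → 1 ≤ c → - + c ≢ + c′
  neg≢pos (suc c) c′ _ ()

∏ : (k : ℕ) → (Fin k → ℤ) → ℤ
∏ zero    f = 1ℤ
∏ (suc k) f = f zero * ∏ k (f ∘ suc)

∏-cong : (k : ℕ) {f g : Fin k → ℤ} → (∀ c → f c ≡ g c) → ∏ k f ≡ ∏ k g
∏-cong zero    f≗g = refl
∏-cong (suc k) f≗g = cong₂ _*_ (f≗g zero) (∏-cong k (f≗g ∘ suc))

∑-allVecs-suc : {A : Set} (xs : List A) (k : ℕ) (F : Vec A (suc k) → ℤ) →
  ∑ (allVecs xs (suc k)) F ≡ ∑[ v ∈ allVecs xs k ] ∑[ x ∈ xs ] F (x ∷ v)
∑-allVecs-suc xs k F =
  trans (∑-concatMap _ (allVecs xs k) F) (∑-cong (allVecs xs k) (λ v → ∑-map (_∷ v) xs F))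

∑-allSubsets-suc : (n : ℕ) (F : Subset (suc n) → ℤ) →
  ∑ (allSubsets (suc n)) F ≡ ∑[ W ∈ allSubsets n ] (F (true ∷ W) + F (false ∷ W))
∑-allSubsets-suc n F =
  trans (∑-allVecs-suc _ n F) (∑-cong (allSubsets n) (λ W → cong (_+_ (F (true ∷ W))) (ℤ.+-identityʳ _)))

⊆ᵇ-∷ : {n : ℕ} (u w : Bool) (U W : Subset n) → ((u ∷ U) ⊆ᵇ (w ∷ W)) ≡ (not u ∨ w) ∧ (U ⊆ᵇ W)
⊆ᵇ-∷ u w U W = all-allFin-suc (λ v → not (lookup (u ∷ U) v) ∨ lookup (w ∷ W) v)

∑-alternating-supersets : (n : ℕ) (U : Subset n) →
  ∑[ W ∈ allSubsets n ] (-1^ (n ℕ.+ ∣ W ∣) * 𝟙 (U ⊆ᵇ W)) ≡ 𝟙 (all (lookup U) (allFin n))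
∑-alternating-supersets zero    []      = refl
∑-alternating-supersets (suc n) (u ∷ U) = begin
  ∑[ W ∈ allSubsets (suc n) ] (-1^ (suc n ℕ.+ ∣ W ∣) * 𝟙 ((u ∷ U) ⊆ᵇ W))
    ≡⟨ ∑-allSubsets-suc n _ ⟩
  ∑[ W ∈ allSubsets n ] (-1^ (suc n ℕ.+ suc ∣ W ∣) * 𝟙 ((u ∷ U) ⊆ᵇ (true ∷ W))
                         + -1^ (suc n ℕ.+ ∣ W ∣) * 𝟙 ((u ∷ U) ⊆ᵇ (false ∷ W)))
    ≡⟨ ∑-cong (allSubsets n) (pair u) ⟩
  ∑[ W ∈ allSubsets n ] (𝟙 u * (-1^ (n ℕ.+ ∣ W ∣) * 𝟙 (U ⊆ᵇ W)))
    ≡⟨ ∑-*ˡ (allSubsets n) (𝟙 u) _ ⟩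
  𝟙 u * ∑[ W ∈ allSubsets n ] (-1^ (n ℕ.+ ∣ W ∣) * 𝟙 (U ⊆ᵇ W))
    ≡⟨ cong (𝟙 u *_) (∑-alternating-supersets n U) ⟩
  𝟙 u * 𝟙 (all (lookup U) (allFin n))
    ≡⟨ sym (𝟙-∧ u _) ⟩
  𝟙 (u ∧ all (lookup U) (allFin n))
    ≡⟨ cong 𝟙 (sym (all-allFin-suc (lookup (u ∷ U)))) ⟩
  𝟙 (all (lookup (u ∷ U)) (allFin (suc n)))
    ∎
  where
  open ≡-Reasoning
  pair : ∀ u W → -1^ (suc n ℕ.+ suc ∣ W ∣) * 𝟙 ((u ∷ U) ⊆ᵇ (true ∷ W))
                 + -1^ (suc n ℕ.+ ∣ W ∣) * 𝟙 ((u ∷ U) ⊆ᵇ (false ∷ W))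
               ≡ 𝟙 u * (-1^ (n ℕ.+ ∣ W ∣) * 𝟙 (U ⊆ᵇ W))
  pair u W rewrite ⊆ᵇ-∷ u true U W | ⊆ᵇ-∷ u false U W | -1^-+-suc (suc n) ∣ W ∣ with u
  ... | true  = solve 2 (λ s b → (:- :- s) :* b :+ (:- s) :* con 0ℤ := con 1ℤ :* (s :* b)) refl
                  (-1^ (n ℕ.+ ∣ W ∣)) (𝟙 (U ⊆ᵇ W))
  ... | false = solve 2 (λ s b → (:- :- s) :* b :+ (:- s) :* b := con 0ℤ :* (s :* b)) refl
                  (-1^ (n ℕ.+ ∣ W ∣)) (𝟙 (U ⊆ᵇ W))

∑-allVecs-𝟙-all≡∏ : {A : Set} (xs : List A) (k : ℕ) (Q : Fin k → A → Bool) →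
  ∑[ T ∈ allVecs xs k ] 𝟙 (all (λ c → Q c (lookup T c)) (allFin k)) ≡ ∏ k (λ c → ∑[ x ∈ xs ] 𝟙 (Q c x))
∑-allVecs-𝟙-all≡∏ xs zero    Q = refl
∑-allVecs-𝟙-all≡∏ xs (suc k) Q = begin
  ∑[ T ∈ allVecs xs (suc k) ] 𝟙 (all (λ c → Q c (lookup T c)) (allFin (suc k)))
    ≡⟨ ∑-allVecs-suc xs k _ ⟩
  ∑[ v ∈ allVecs xs k ] ∑[ x ∈ xs ] 𝟙 (all (λ c → Q c (lookup (x ∷ v) c)) (allFin (suc k)))
    ≡⟨ ∑-cong (allVecs xs k) (λ v → ∑-cong xs (λ x →
         trans (cong 𝟙 (all-allFin-suc (λ c → Q c (lookup (x ∷ v) c)))) (𝟙-∧ (Q zero x) (R v)))) ⟩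
  ∑[ v ∈ allVecs xs k ] ∑[ x ∈ xs ] (𝟙 (Q zero x) * 𝟙 (R v))
    ≡⟨ ∑-cong (allVecs xs k) (λ v → ∑-*ʳ xs (𝟙 ∘ Q zero) (𝟙 (R v))) ⟩
  ∑[ v ∈ allVecs xs k ] (∑ xs (𝟙 ∘ Q zero) * 𝟙 (R v))
    ≡⟨ ∑-*ˡ (allVecs xs k) (∑ xs (𝟙 ∘ Q zero)) (𝟙 ∘ R) ⟩
  ∑ xs (𝟙 ∘ Q zero) * ∑ (allVecs xs k) (𝟙 ∘ R)
    ≡⟨ cong (∑ xs (𝟙 ∘ Q zero) *_) (∑-allVecs-𝟙-all≡∏ xs k (Q ∘ suc)) ⟩
  ∏ (suc k) (λ c → ∑[ x ∈ xs ] 𝟙 (Q c x))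
    ∎
  where
  open ≡-Reasoning
  R : Vec _ k → Bool
  R v = all (λ c → Q (suc c) (lookup v c)) (allFin k)

-- Set colourings as tuples of colour classes

transpose : {A : Set} {n k : ℕ} → Vec (Vec A n) k → Vec (Vec A k) n
transpose T = tabulate (λ v → tabulate (λ c → lookup (lookup T c) v))

lookup-transpose : {A : Set} {n k : ℕ} (T : Vec (Vec A n) k) (v : Fin n) (c : Fin k) →
  lookup (lookup (transpose T) v) c ≡ lookup (lookup T c) v
lookup-transpose T v c =
  trans (cong (λ r → lookup r c) (lookup∘tabulate _ v)) (lookup∘tabulate (λ c → lookup (lookup T c) v) c)

transpose-involutive : {A : Set} {n k : ℕ} (T : Vec (Vec A n) k) → transpose (transpose T) ≡ T
transpose-involutive T = trans
  (tabulate-cong (λ c → trans (tabulate-cong (λ v → lookup-transpose T v c)) (tabulate∘lookup (lookup T c))))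
  (tabulate∘lookup T)

transpose-↔ : {A : Set} {n k : ℕ} → Vec (Vec A n) k ↔ Vec (Vec A k) n
transpose-↔ = mk↔ₛ′ transpose transpose transpose-involutive transpose-involutive

count-lookup≡∣∣ : {n : ℕ} (S : Subset n) → count (lookup S) (allFin n) ≡ ∣ S ∣
count-lookup≡∣∣ []          = refl
count-lookup≡∣∣ (true  ∷ S) = trans (count-allFin-suc (lookup (true ∷ S))) (cong suc (count-lookup≡∣∣ S))
count-lookup≡∣∣ (false ∷ S) = trans (count-allFin-suc (lookup (false ∷ S))) (count-lookup≡∣∣ S)

⋃ : {n k : ℕ} → Vec (Subset n) k → Subset n
⋃ {k = k} T = tabulate (λ v → any (λ c → v ∈ᵇ lookup T c) (allFin k))

⋃-⊆ᵇ : {n k : ℕ} (T : Vec (Subset n) k) (W : Subset n) → (⋃ T ⊆ᵇ W) ≡ all (λ c → lookup T c ⊆ᵇ W) (allFin k)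
⋃-⊆ᵇ {n} {k} T W = sym (trans
  (all-comm (allFin k) (allFin n) (λ c v → not (v ∈ᵇ lookup T c) ∨ (v ∈ᵇ W)))
  (all-cong (allFin n) (λ v → trans (all-not-∨ (allFin k) (λ c → v ∈ᵇ lookup T c) (v ∈ᵇ W))
                                     (cong (λ b → not b ∨ (v ∈ᵇ W)) (sym (lookup∘tabulate _ v))))))

𝟙-full≡∑-alternating : {n k : ℕ} (T : Vec (Subset n) k) →
  𝟙 (all (lookup (⋃ T)) (allFin n))
    ≡ ∑[ W ∈ allSubsets n ] (-1^ (n ℕ.+ ∣ W ∣) * 𝟙 (all (λ c → lookup T c ⊆ᵇ W) (allFin k)))
𝟙-full≡∑-alternating {n} T = trans (sym (∑-alternating-supersets n (⋃ T)))
  (∑-cong (allSubsets n) (λ W → cong (λ b → -1^ (n ℕ.+ ∣ W ∣) * 𝟙 b) (⋃-⊆ᵇ T W)))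

-- A colouring κ lists the colours of each vertex; its transpose lists the colour classes κ⁻¹(c).
module _ {n : ℕ} (G : SimpleGraph n) {k : ℕ} (T : Vec (Subset n) k) where

  nonempty-transpose :
    all (λ v → any (λ c → c ∈ᵇ lookup (transpose T) v) (allFin k)) (allFin n) ≡ all (lookup (⋃ T)) (allFin n)
  nonempty-transpose = all-cong (allFin n) (λ v →
    trans (any-cong (allFin k) (λ c → lookup-transpose T v c)) (sym (lookup∘tabulate _ v)))

  disjoint-transpose :
    all (λ u → all (λ v → not (adj G u v)
          ∨ all (λ c → not ((c ∈ᵇ lookup (transpose T) u) ∧ (c ∈ᵇ lookup (transpose T) v))) (allFin k))
        (allFin n)) (allFin n)
      ≡ all (λ c → isIndependent G (lookup T c)) (allFin k)
  disjoint-transpose = trans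
    (all-cong (allFin n) (λ u → trans
      (all-cong (allFin n) (λ v → trans (∨-all (not (adj G u v)) (allFin k) _)
        (all-cong (allFin k) (λ c → trans
          (cong₂ (λ x y → not (adj G u v) ∨ not (x ∧ y)) (lookup-transpose T u c) (lookup-transpose T v c))
          (not∨not (adj G u v) (lookup (lookup T c) u) (lookup (lookup T c) v))))))
      (all-comm (allFin n) (allFin k) _)))
    (all-comm (allFin n) (allFin k) _)
    where
    not∨not : ∀ a x y → not a ∨ not (x ∧ y) ≡ not (x ∧ y ∧ a)
    not∨not a     false y     = Bool.∨-zeroʳ (not a)
    not∨not a     true  false = Bool.∨-zeroʳ (not a)
    not∨not true  true  true  = refl
    not∨not false true  true  = refl

  colorMultiplicity-transpose : ∀ c → colorMultiplicity (transpose T) c ≡ ∣ lookup T c ∣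
  colorMultiplicity-transpose c =
    trans (count-cong (allFin n) (λ v → lookup-transpose T v c)) (count-lookup≡∣∣ (lookup T c))

module _ {n : ℕ} (G : SimpleGraph n) (k : ℕ) (α : Vec ℕ k) where

  hasMonomial : Vec (Subset k) n → Bool
  hasMonomial κ = isProperSetColoring G κ ∧ all (λ c → colorMultiplicity κ c ≡ᵇ lookup α c) (allFin k)

  admissibleClasses : Vec (Subset n) k → Bool
  admissibleClasses T = all (λ c → isIndependent G (lookup T c) ∧ (∣ lookup T c ∣ ≡ᵇ lookup α c)) (allFin k)

  hasMonomial-transpose : (T : Vec (Subset n) k) →
    hasMonomial (transpose T) ≡ all (lookup (⋃ T)) (allFin n) ∧ admissibleClasses T
  hasMonomial-transpose T = begin
    hasMonomial (transpose T)
      ≡⟨ cong₂ _∧_ (cong₂ _∧_ (nonempty-transpose G T) (disjoint-transpose G T))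
                   (all-cong (allFin k) (λ c → cong (_≡ᵇ lookup α c) (colorMultiplicity-transpose G T c))) ⟩
    (covered ∧ all independent (allFin k)) ∧ all sized (allFin k)
      ≡⟨ Bool.∧-assoc covered _ _ ⟩
    covered ∧ (all independent (allFin k) ∧ all sized (allFin k))
      ≡⟨ cong (covered ∧_) (sym (all-∧ (allFin k) independent sized)) ⟩
    covered ∧ admissibleClasses T
      ∎
    where
    open ≡-Reasoning
    covered = all (lookup (⋃ T)) (allFin n)
    independent sized : Fin k → Bool
    independent c = isIndependent G (lookup T c)
    sized c = ∣ lookup T c ∣ ≡ᵇ lookup α c

  ∑-admissibleClasses-⊆ : (W : Subset n) →
    ∑[ T ∈ allVecs (allSubsets n) k ] 𝟙 (all (λ c → lookup T c ⊆ᵇ W) (allFin k) ∧ admissibleClasses T)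
      ≡ ∏ k (λ c → + indPolyInduced G W (lookup α c))
  ∑-admissibleClasses-⊆ W = begin
    ∑[ T ∈ allVecs (allSubsets n) k ] 𝟙 (all (λ c → lookup T c ⊆ᵇ W) (allFin k) ∧ admissibleClasses T)
      ≡⟨ ∑-cong (allVecs (allSubsets n) k) (λ T → cong 𝟙 (sym (all-∧ (allFin k) _ _))) ⟩
    ∑[ T ∈ allVecs (allSubsets n) k ] 𝟙 (all (λ c → Q c (lookup T c)) (allFin k))
      ≡⟨ ∑-allVecs-𝟙-all≡∏ (allSubsets n) k Q ⟩
    ∏ k (λ c → ∑[ S ∈ allSubsets n ] 𝟙 (Q c S))
      ≡⟨ ∏-cong k (λ c → sym (count≡∑𝟙 (Q c) (allSubsets n))) ⟩
    ∏ k (λ c → + indPolyInduced G W (lookup α c))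
      ∎
    where
    open ≡-Reasoning
    Q : Fin k → Subset n → Bool
    Q c S = (S ⊆ᵇ W) ∧ isIndependent G S ∧ (∣ S ∣ ≡ᵇ lookup α c)

  kromaticCoeff-expansion : + kromaticCoeff G k α
    ≡ ∑[ W ∈ allSubsets n ] (-1^ (n ℕ.+ ∣ W ∣) * ∏ k (λ c → + indPolyInduced G W (lookup α c)))
  kromaticCoeff-expansion = begin
    + kromaticCoeff G k α
      ≡⟨ count≡∑𝟙 hasMonomial (allVecs (allSubsets k) n) ⟩
    ∑[ κ ∈ allVecs (allSubsets k) n ] 𝟙 (hasMonomial κ)
      ≡⟨ sym (∑-reindex (allVecs-isEnumeration (allSubsets-isEnumeration n) k)
                        (allVecs-isEnumeration (allSubsets-isEnumeration k) n) transpose-↔ (𝟙 ∘ hasMonomial)) ⟩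
    ∑[ T ∈ Ts ] 𝟙 (hasMonomial (transpose T))
      ≡⟨ ∑-cong Ts (λ T → trans (cong 𝟙 (hasMonomial-transpose T)) (𝟙-∧ (covered T) (admissibleClasses T))) ⟩
    ∑[ T ∈ Ts ] (𝟙 (covered T) * 𝟙 (admissibleClasses T))
      ≡⟨ ∑-cong Ts (λ T → trans (cong (_* 𝟙 (admissibleClasses T)) (𝟙-full≡∑-alternating T))
                                (sym (∑-*ʳ Ws _ (𝟙 (admissibleClasses T))))) ⟩
    ∑[ T ∈ Ts ] ∑[ W ∈ Ws ] (sign W * 𝟙 (inside W T) * 𝟙 (admissibleClasses T))
      ≡⟨ ∑-comm Ts Ws _ ⟩
    ∑[ W ∈ Ws ] ∑[ T ∈ Ts ] (sign W * 𝟙 (inside W T) * 𝟙 (admissibleClasses T))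
      ≡⟨ ∑-cong Ws (λ W → trans (∑-cong Ts (regroup W)) (∑-*ˡ Ts (sign W) (λ T → 𝟙 (admissibleInside W T)))) ⟩
    ∑[ W ∈ Ws ] (sign W * ∑[ T ∈ Ts ] 𝟙 (admissibleInside W T))
      ≡⟨ ∑-cong Ws (λ W → cong (sign W *_) (∑-admissibleClasses-⊆ W)) ⟩
    ∑[ W ∈ Ws ] (sign W * ∏ k (λ c → + indPolyInduced G W (lookup α c)))
      ∎
    where
    open ≡-Reasoning
    Ts = allVecs (allSubsets n) k
    Ws = allSubsets n
    sign : Subset n → ℤ
    sign W = -1^ (n ℕ.+ ∣ W ∣)
    covered : Vec (Subset n) k → Bool
    covered T = all (lookup (⋃ T)) (allFin n)
    inside : Subset n → Vec (Subset n) k → Bool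
    inside W T = all (λ c → lookup T c ⊆ᵇ W) (allFin k)
    admissibleInside : Subset n → Vec (Subset n) k → Bool
    admissibleInside W T = inside W T ∧ admissibleClasses T
    regroup : ∀ W T → sign W * 𝟙 (inside W T) * 𝟙 (admissibleClasses T) ≡ sign W * 𝟙 (admissibleInside W T)
    regroup W T = trans (ℤ.*-assoc (sign W) _ _) (cong (sign W *_) (sym (𝟙-∧ (inside W T) (admissibleClasses T))))

-- Extreme coefficients of independence polynomials

∈ᵇ⇒1≤∣∣ : {n : ℕ} (S : Subset n) (u : Fin n) → u ∈ᵇ S ≡ true → 1 ≤ ∣ S ∣
∈ᵇ⇒1≤∣∣ (true  ∷ S) zero    _   = s≤s z≤n
∈ᵇ⇒1≤∣∣ (true  ∷ S) (suc u) _   = s≤s z≤n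
∈ᵇ⇒1≤∣∣ (false ∷ S) (suc u) u∈S = ∈ᵇ⇒1≤∣∣ S u u∈S

∈ᵇ-≢⇒2≤∣∣ : {n : ℕ} (S : Subset n) (u v : Fin n) → u ∈ᵇ S ≡ true → v ∈ᵇ S ≡ true → ¬ u ≡ v → 2 ≤ ∣ S ∣
∈ᵇ-≢⇒2≤∣∣ (_     ∷ S) zero    zero    _   _   u≢v = ⊥-elim (u≢v refl)
∈ᵇ-≢⇒2≤∣∣ (true  ∷ S) zero    (suc v) _   v∈S _   = s≤s (∈ᵇ⇒1≤∣∣ S v v∈S)
∈ᵇ-≢⇒2≤∣∣ (true  ∷ S) (suc u) zero    u∈S _   _   = s≤s (∈ᵇ⇒1≤∣∣ S u u∈S)
∈ᵇ-≢⇒2≤∣∣ (true  ∷ S) (suc u) (suc v) u∈S v∈S u≢v =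
  ℕ.m≤n⇒m≤1+n (∈ᵇ-≢⇒2≤∣∣ S u v u∈S v∈S (u≢v ∘ cong suc))
∈ᵇ-≢⇒2≤∣∣ (false ∷ S) (suc u) (suc v) u∈S v∈S u≢v = ∈ᵇ-≢⇒2≤∣∣ S u v u∈S v∈S (u≢v ∘ cong suc)

∣∣≤1⇒isIndependent : {n : ℕ} (G : SimpleGraph n) (S : Subset n) → ∣ S ∣ ≤ 1 → isIndependent G S ≡ true
∣∣≤1⇒isIndependent {n} G S ∣S∣≤1 =
  trans (all-cong (allFin n) (λ u → trans (all-cong (allFin n) (no-edge u)) (all-true (allFin n))))
        (all-true (allFin n))
  where
  no-edge : ∀ u v → not ((u ∈ᵇ S) ∧ (v ∈ᵇ S) ∧ adj G u v) ≡ true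
  no-edge u v with u ∈ᵇ S in u∈S | v ∈ᵇ S in v∈S
  ... | false | _     = refl
  ... | true  | false = refl
  ... | true  | true  with u Fin.≟ v
  ...   | yes refl rewrite irrefl G u = refl
  ...   | no u≢v   = ⊥-elim (ℕ.<-irrefl refl (ℕ.≤-trans (∈ᵇ-≢⇒2≤∣∣ S u v u∈S v∈S u≢v) ∣S∣≤1))

#subsetsOfSize : (n : ℕ) → Subset n → ℕ → ℤ
#subsetsOfSize n W m = ∑[ S ∈ allSubsets n ] 𝟙 ((S ⊆ᵇ W) ∧ (∣ S ∣ ≡ᵇ m))

#subsetsOfSize-0 : (n : ℕ) (W : Subset n) → #subsetsOfSize n W 0 ≡ 1ℤ
#subsetsOfSize-0 zero    []      = refl
#subsetsOfSize-0 (suc n) (w ∷ W) =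
  trans (∑-allSubsets-suc n _) (trans (∑-cong (allSubsets n) only-false) (#subsetsOfSize-0 n W))
  where
  only-false : ∀ S → 𝟙 (((true ∷ S) ⊆ᵇ (w ∷ W)) ∧ false) + 𝟙 (((false ∷ S) ⊆ᵇ (w ∷ W)) ∧ (∣ S ∣ ≡ᵇ 0))
                     ≡ 𝟙 ((S ⊆ᵇ W) ∧ (∣ S ∣ ≡ᵇ 0))
  only-false S rewrite Bool.∧-zeroʳ ((true ∷ S) ⊆ᵇ (w ∷ W)) | ⊆ᵇ-∷ false w S W = ℤ.+-identityˡ _

#subsetsOfSize-1 : (n : ℕ) (W : Subset n) → #subsetsOfSize n W 1 ≡ + ∣ W ∣
#subsetsOfSize-1 zero    []      = refl
#subsetsOfSize-1 (suc n) (w ∷ W) = begin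
  #subsetsOfSize (suc n) (w ∷ W) 1
    ≡⟨ ∑-allSubsets-suc n _ ⟩
  ∑[ S ∈ allSubsets n ] (𝟙 (((true ∷ S) ⊆ᵇ (w ∷ W)) ∧ (∣ S ∣ ≡ᵇ 0)) + 𝟙 (((false ∷ S) ⊆ᵇ (w ∷ W)) ∧ (∣ S ∣ ≡ᵇ 1)))
    ≡⟨ ∑-cong (allSubsets n) split ⟩
  ∑[ S ∈ allSubsets n ] (𝟙 w * 𝟙 ((S ⊆ᵇ W) ∧ (∣ S ∣ ≡ᵇ 0)) + 𝟙 ((S ⊆ᵇ W) ∧ (∣ S ∣ ≡ᵇ 1)))
    ≡⟨ ∑-distrib-+ (allSubsets n) _ _ ⟩
  ∑[ S ∈ allSubsets n ] (𝟙 w * 𝟙 ((S ⊆ᵇ W) ∧ (∣ S ∣ ≡ᵇ 0))) + #subsetsOfSize n W 1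
    ≡⟨ cong₂ _+_ (trans (∑-*ˡ (allSubsets n) (𝟙 w) _) (cong (𝟙 w *_) (#subsetsOfSize-0 n W)))
                 (#subsetsOfSize-1 n W) ⟩
  𝟙 w * 1ℤ + + ∣ W ∣
    ≡⟨ size-∷ w ⟩
  + ∣ w ∷ W ∣
    ∎
  where
  open ≡-Reasoning
  split : ∀ S → 𝟙 (((true ∷ S) ⊆ᵇ (w ∷ W)) ∧ (∣ S ∣ ≡ᵇ 0)) + 𝟙 (((false ∷ S) ⊆ᵇ (w ∷ W)) ∧ (∣ S ∣ ≡ᵇ 1))
                ≡ 𝟙 w * 𝟙 ((S ⊆ᵇ W) ∧ (∣ S ∣ ≡ᵇ 0)) + 𝟙 ((S ⊆ᵇ W) ∧ (∣ S ∣ ≡ᵇ 1))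
  split S rewrite ⊆ᵇ-∷ true w S W | ⊆ᵇ-∷ false w S W | Bool.∧-assoc w (S ⊆ᵇ W) (∣ S ∣ ≡ᵇ 0) =
    cong (_+ 𝟙 ((S ⊆ᵇ W) ∧ (∣ S ∣ ≡ᵇ 1))) (𝟙-∧ w _)
  size-∷ : ∀ w → 𝟙 w * 1ℤ + + ∣ W ∣ ≡ + ∣ w ∷ W ∣
  size-∷ true  = refl
  size-∷ false = ℤ.+-identityˡ _

indPolyInduced-1 : {n : ℕ} (G : SimpleGraph n) (W : Subset n) → indPolyInduced G W 1 ≡ ∣ W ∣
indPolyInduced-1 {n} G W = ℤ.+-injective (trans (count≡∑𝟙 _ (allSubsets n))
  (trans (∑-cong (allSubsets n) (λ S → cong 𝟙 (singletons-independent S))) (#subsetsOfSize-1 n W)))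
  where
  singletons-independent : ∀ S → ((S ⊆ᵇ W) ∧ isIndependent G S ∧ (∣ S ∣ ≡ᵇ 1)) ≡ ((S ⊆ᵇ W) ∧ (∣ S ∣ ≡ᵇ 1))
  singletons-independent S with ∣ S ∣ ≡ᵇ 1 in ∣S∣≡1
  ... | false rewrite Bool.∧-zeroʳ (isIndependent G S) = refl
  ... | true  rewrite ∣∣≤1⇒isIndependent G S (ℕ.≤-reflexive (ℕ.≡ᵇ⇒≡ _ 1 (subst T (sym ∣S∣≡1) _))) = refl

indPolyInduced-vanishes : {n : ℕ} (G : SimpleGraph n) (W : Subset n) {m : ℕ} → n < m → indPolyInduced G W m ≡ 0
indPolyInduced-vanishes {n} G W {m} n<m = ℤ.+-injective (trans (count≡∑𝟙 _ (allSubsets n))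
  (trans (∑-cong (allSubsets n) (λ S → cong 𝟙 (too-large S))) (∑-zero (allSubsets n))))
  where
  too-large : ∀ S → ((S ⊆ᵇ W) ∧ isIndependent G S ∧ (∣ S ∣ ≡ᵇ m)) ≡ false
  too-large S with ∣ S ∣ ≡ᵇ m in ∣S∣≡m
  ... | false = trans (cong ((S ⊆ᵇ W) ∧_) (Bool.∧-zeroʳ _)) (Bool.∧-zeroʳ _)
  ... | true  = ⊥-elim (ℕ.<-irrefl (ℕ.≡ᵇ⇒≡ _ m (subst T (sym ∣S∣≡m) _)) (ℕ.≤-<-trans (∣p∣≤n S) n<m))

-- Signed point measures are determined by their moments

∫ : {A : Set} → List (ℤ × A) → (A → ℤ) → ℤ
∫ μ f = ∑[ p ∈ μ ] (proj₁ p * f (proj₂ p))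

module _ {A : Set} where

  ∫-cong-∈ : (μ : List (ℤ × A)) {f g : A → ℤ} → (∀ {x} → x ∈ map proj₂ μ → f x ≡ g x) → ∫ μ f ≡ ∫ μ g
  ∫-cong-∈ []      f≗g = refl
  ∫-cong-∈ (p ∷ μ) f≗g = cong₂ _+_ (cong (proj₁ p *_) (f≗g (here refl))) (∫-cong-∈ μ (f≗g ∘ there))

  ∫-cong : (μ : List (ℤ × A)) {f g : A → ℤ} → (∀ x → f x ≡ g x) → ∫ μ f ≡ ∫ μ g
  ∫-cong μ f≗g = ∫-cong-∈ μ (λ {x} _ → f≗g x)

  ∫-*ʳ : (μ : List (ℤ × A)) (f : A → ℤ) (c : ℤ) → ∫ μ (λ x → f x * c) ≡ ∫ μ f * c
  ∫-*ʳ μ f c = trans (∑-cong μ (λ p → sym (ℤ.*-assoc (proj₁ p) (f (proj₂ p)) c))) (∑-*ʳ μ _ c)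

  ∫-linear : (μ : List (ℤ × A)) (f g : A → ℤ) (c : ℤ) →
    ∫ μ (λ x → f x + c * g x) ≡ ∫ μ f + c * ∫ μ g
  ∫-linear μ f g c = trans
    (∑-cong μ (λ (w , x) →
      solve 4 (λ w a b c → w :* (a :+ c :* b) := w :* a :+ c :* (w :* b)) refl w (f x) (g x) c))
    (trans (∑-distrib-+ μ _ _) (cong (_+_ (∫ μ f)) (∑-*ˡ μ c _)))

module _ {D : ℕ} where

  _≟ᵛ_ : DecidableEquality (Vec ℕ D)
  _≟ᵛ_ = ≡-dec ℕ._≟_

  monomial : {k : ℕ} → Vec ℕ D → Vec (Fin D) k → ℤ
  monomial {k} x β = ∏ k (λ c → + lookup x (lookup β c))

  massAt : List (ℤ × Vec ℕ D) → Vec ℕ D → ℤ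
  massAt μ y = ∫ μ (λ x → 𝟙 ⌊ x ≟ᵛ y ⌋)

  Annihilates : List (ℤ × Vec ℕ D) → (Vec ℕ D → ℤ) → Set
  Annihilates μ f = ∀ k (β : Vec (Fin D) k) → ∫ μ (λ x → f x * monomial x β) ≡ 0ℤ

  annihilates-*-affine : (μ : List (ℤ × Vec ℕ D)) {f : Vec ℕ D → ℤ} → Annihilates μ f →
    ∀ j c → Annihilates μ (λ x → f x * (+ lookup x j - c))
  annihilates-*-affine μ {f} ann j c k β = begin
    ∫ μ (λ x → f x * (+ lookup x j - c) * monomial x β)
      ≡⟨ ∫-cong μ (λ x → solve 4 (λ f a c m → f :* (a :- c) :* m := f :* (a :* m) :+ (:- c) :* (f :* m)) refl
                                 (f x) (+ lookup x j) c (monomial x β)) ⟩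
    ∫ μ (λ x → f x * monomial x (j ∷ β) + (- c) * (f x * monomial x β))
      ≡⟨ ∫-linear μ _ _ (- c) ⟩
    ∫ μ (λ x → f x * monomial x (j ∷ β)) + (- c) * ∫ μ (λ x → f x * monomial x β)
      ≡⟨ cong₂ (λ a b → a + (- c) * b) (ann (suc k) (j ∷ β)) (ann k β) ⟩
    0ℤ + (- c) * 0ℤ
      ≡⟨ trans (ℤ.+-identityˡ _) (ℤ.*-zeroʳ (- c)) ⟩
    0ℤ
      ∎
    where open ≡-Reasoning

differingCoordinate : {d : ℕ} {y z : Vec ℕ d} → ¬ y ≡ z → ∃ λ j → ¬ lookup y j ≡ lookup z j
differingCoordinate {y = []}    {[]}    y≢z = ⊥-elim (y≢z refl)
differingCoordinate {y = a ∷ y} {b ∷ z} y≢z with a ℕ.≟ b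
... | no a≢b   = zero , a≢b
... | yes refl with differingCoordinate (y≢z ∘ cong (a ∷_))
...   | j , yⱼ≢zⱼ = suc j , yⱼ≢zⱼ

module _ {D : ℕ} (y : Vec ℕ D) where

  -- The separator of y is the product, over the listed points z ≢ y, of x_j − z_j for a
  -- coordinate j where z and y differ: it vanishes at every listed point except y.
  separatingFactor : (z : Vec ℕ D) → Dec (z ≡ y) → Vec ℕ D → ℤ
  separatingFactor z (yes _)   x = 1ℤ
  separatingFactor z (no z≢y)  x = + lookup x j - + lookup z j
    where j = proj₁ (differingCoordinate z≢y)

  separator : List (Vec ℕ D) → Vec ℕ D → ℤ
  separator []       x = 1ℤ
  separator (z ∷ zs) x = separator zs x * separatingFactor z (z ≟ᵛ y) x

  separatingFactor-annihilates : (μ : List (ℤ × Vec ℕ D)) {f : Vec ℕ D → ℤ} → Annihilates μ f →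
    ∀ z d → Annihilates μ (λ x → f x * separatingFactor z d x)
  separatingFactor-annihilates μ {f} ann z (yes _)  k β =
    trans (∫-cong μ (λ x → cong (_* monomial x β) (ℤ.*-identityʳ (f x)))) (ann k β)
  separatingFactor-annihilates μ {f} ann z (no z≢y)     =
    annihilates-*-affine μ {f} ann (proj₁ (differingCoordinate z≢y)) (+ lookup z (proj₁ (differingCoordinate z≢y)))

  separator-annihilates : (μ : List (ℤ × Vec ℕ D)) → Annihilates μ (λ _ → 1ℤ) → ∀ zs → Annihilates μ (separator zs)
  separator-annihilates μ ann []       = ann
  separator-annihilates μ ann (z ∷ zs) =
    separatingFactor-annihilates μ {separator zs} (separator-annihilates μ ann zs) z (z ≟ᵛ y)

  separatingFactor-nonzero : ∀ z d → ¬ separatingFactor z d y ≡ 0ℤ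
  separatingFactor-nonzero z (yes _)  ()
  separatingFactor-nonzero z (no z≢y) yⱼ-zⱼ≡0 = zⱼ≢yⱼ (sym (ℤ.+-injective (ℤ.i-j≡0⇒i≡j _ _ yⱼ-zⱼ≡0)))
    where zⱼ≢yⱼ = proj₂ (differingCoordinate z≢y)

  separatingFactor-vanishes : ∀ {z} d → ¬ z ≡ y → separatingFactor z d z ≡ 0ℤ
  separatingFactor-vanishes (yes z≡y) z≢y = ⊥-elim (z≢y z≡y)
  separatingFactor-vanishes {z} (no _) _  = ℤ.+-inverseʳ (+ lookup z _)

  separator-nonzero : ∀ zs → ¬ separator zs y ≡ 0ℤ
  separator-nonzero []       ()
  separator-nonzero (z ∷ zs) eq with ℤ.i*j≡0⇒i≡0∨j≡0 (separator zs y) eq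
  ... | inj₁ eq′ = separator-nonzero zs eq′
  ... | inj₂ eq′ = separatingFactor-nonzero z (z ≟ᵛ y) eq′

  separator-vanishes : ∀ {z} zs → z ∈ zs → ¬ z ≡ y → separator zs z ≡ 0ℤ
  separator-vanishes {z} (z′ ∷ zs) (here refl) z≢y =
    trans (cong (separator zs z *_) (separatingFactor-vanishes (z ≟ᵛ y) z≢y)) (ℤ.*-zeroʳ (separator zs z))
  separator-vanishes {z} (z′ ∷ zs) (there z∈zs) z≢y =
    trans (cong (_* separatingFactor z′ (z′ ≟ᵛ y) z) (separator-vanishes zs z∈zs z≢y))
          (ℤ.*-zeroˡ (separatingFactor z′ (z′ ≟ᵛ y) z))

moments-vanish⇒massAt-vanishes : {D : ℕ} (μ : List (ℤ × Vec ℕ D)) →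
  (∀ k (β : Vec (Fin D) k) → ∫ μ (λ x → monomial x β) ≡ 0ℤ) → ∀ y → massAt μ y ≡ 0ℤ
moments-vanish⇒massAt-vanishes {D} μ moments y =
  [ id , ⊥-elim ∘ separator-nonzero y (map proj₂ μ) ]′ (ℤ.i*j≡0⇒i≡0∨j≡0 (massAt μ y) mass*sep≡0)
  where
  sep : Vec ℕ D → ℤ
  sep = separator y (map proj₂ μ)
  constant-annihilated : Annihilates μ (λ _ → 1ℤ)
  constant-annihilated k β = trans (∫-cong μ (λ x → ℤ.*-identityˡ (monomial x β))) (moments k β)
  concentrated : ∀ {x} → x ∈ map proj₂ μ → 𝟙 ⌊ x ≟ᵛ y ⌋ * sep y ≡ sep x * 1ℤ
  concentrated {x} x∈μ with x ≟ᵛ y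
  ... | yes refl = trans (ℤ.*-identityˡ (sep x)) (sym (ℤ.*-identityʳ (sep x)))
  ... | no x≢y   = sym (trans (ℤ.*-identityʳ (sep x)) (separator-vanishes y (map proj₂ μ) x∈μ x≢y))
  mass*sep≡0 : massAt μ y * sep y ≡ 0ℤ
  mass*sep≡0 = begin
    massAt μ y * sep y                    ≡⟨ ∫-*ʳ μ (λ x → 𝟙 ⌊ x ≟ᵛ y ⌋) (sep y) ⟨
    ∫ μ (λ x → 𝟙 ⌊ x ≟ᵛ y ⌋ * sep y)      ≡⟨ ∫-cong-∈ μ concentrated ⟩
    ∫ μ (λ x → sep x * monomial x [])     ≡⟨ separator-annihilates y μ constant-annihilated (map proj₂ μ) 0 [] ⟩
    0ℤ                                    ∎
    where open ≡-Reasoning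

negate : {A : Set} → List (ℤ × A) → List (ℤ × A)
negate = map (λ (w , x) → - w , x)

∫-difference : {A : Set} (μ ν : List (ℤ × A)) (f : A → ℤ) → ∫ (μ ++ negate ν) f ≡ ∫ μ f - ∫ ν f
∫-difference μ ν f = trans (∑-++ μ (negate ν) _) (cong (_+_ (∫ μ f))
  (trans (∑-map _ ν _) (trans (∑-cong ν (λ (w , x) → sym (ℤ.neg-distribˡ-* w (f x)))) (∑-neg ν _))))

size-preserving⇒≡ : {n n′ : ℕ} (σ : Subset n ↔ Subset n′) → (∀ W → ∣ W ∣ ≡ ∣ Inverse.to σ W ∣) → n ≡ n′
size-preserving⇒≡ {n} {n′} σ ∣σ∣≡ = ℕ.≤-antisym
  (subst (_≤ n′) (trans (sym (∣σ∣≡ ⊤)) (∣⊤∣≡n n)) (∣p∣≤n (to ⊤)))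
  (subst (_≤ n) (trans (trans (∣σ∣≡ (from ⊤)) (cong ∣_∣ (strictlyInverseˡ ⊤))) (∣⊤∣≡n n′)) (∣p∣≤n (from ⊤)))
  where open Inverse σ

sameIndPolyMultiset⇒kromaticEq : {n n′ : ℕ} (G : SimpleGraph n) (G′ : SimpleGraph n′) →
  SameIndPolyMultiset G G′ → KromaticEq G G′
sameIndPolyMultiset⇒kromaticEq {n} {n′} G G′ (σ , same) k α = ℤ.+-injective (begin
  + kromaticCoeff G k α
    ≡⟨ kromaticCoeff-expansion G k α ⟩
  ∑[ W ∈ allSubsets n ] (-1^ (n ℕ.+ ∣ W ∣) * ∏ k (λ c → + indPolyInduced G W (lookup α c)))
    ≡⟨ ∑-cong (allSubsets n) (λ W → cong₂ _*_ (cong -1^_ (cong₂ ℕ._+_ n≡n′ (∣σ∣≡ W)))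
                                                 (∏-cong k (λ c → cong +_ (same W (lookup α c))))) ⟩
  ∑[ W ∈ allSubsets n ] term (to W)
    ≡⟨ ∑-reindex (allSubsets-isEnumeration n) (allSubsets-isEnumeration n′) σ term ⟩
  ∑[ W ∈ allSubsets n′ ] term W
    ≡⟨ kromaticCoeff-expansion G′ k α ⟨
  + kromaticCoeff G′ k α
    ∎)
  where
  open ≡-Reasoning
  open Inverse σ
  term : Subset n′ → ℤ
  term W = -1^ (n′ ℕ.+ ∣ W ∣) * ∏ k (λ c → + indPolyInduced G′ W (lookup α c))
  ∣σ∣≡ : ∀ W → ∣ W ∣ ≡ ∣ to W ∣
  ∣σ∣≡ W = trans (sym (indPolyInduced-1 G W)) (trans (same W 1) (indPolyInduced-1 G′ (to W)))
  n≡n′ : n ≡ n′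
  n≡n′ = size-preserving⇒≡ σ ∣σ∣≡

module _ (d : ℕ) where

  point : {m : ℕ} → SimpleGraph m → Subset m → Vec ℕ (2 ℕ.+ d)
  point H W = tabulate (λ j → indPolyInduced H W (toℕ j))

  lookup-point : {m : ℕ} (H : SimpleGraph m) (W : Subset m) (j : Fin (2 ℕ.+ d)) →
    lookup (point H W) j ≡ indPolyInduced H W (toℕ j)
  lookup-point H W = lookup∘tabulate (λ j → indPolyInduced H W (toℕ j))

  size : Vec ℕ (2 ℕ.+ d) → ℕ
  size y = lookup y (suc zero)

  size-point : {m : ℕ} (H : SimpleGraph m) (W : Subset m) → size (point H W) ≡ ∣ W ∣
  size-point H W = trans (lookup-point H W (suc zero)) (indPolyInduced-1 H W)

  weightedPoints : {m : ℕ} → SimpleGraph m → List (ℤ × Vec ℕ (2 ℕ.+ d))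
  weightedPoints {m} H = map (λ W → -1^ (m ℕ.+ ∣ W ∣) , point H W) (allSubsets m)

  ∫-weightedPoints-monomial : {m : ℕ} (H : SimpleGraph m) {k : ℕ} (β : Vec (Fin (2 ℕ.+ d)) k) →
    ∫ (weightedPoints H) (λ x → monomial x β) ≡ + kromaticCoeff H k (Vec.map toℕ β)
  ∫-weightedPoints-monomial {m} H {k} β = begin
    ∫ (weightedPoints H) (λ x → monomial x β)
      ≡⟨ ∑-map _ (allSubsets m) _ ⟩
    ∑[ W ∈ allSubsets m ] (-1^ (m ℕ.+ ∣ W ∣) * monomial (point H W) β)
      ≡⟨ ∑-cong (allSubsets m) (λ W → cong (-1^ (m ℕ.+ ∣ W ∣) *_) (∏-cong k (λ c → cong +_ (coefficient W c)))) ⟩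
    ∑[ W ∈ allSubsets m ] (-1^ (m ℕ.+ ∣ W ∣) * ∏ k (λ c → + indPolyInduced H W (lookup α c)))
      ≡⟨ kromaticCoeff-expansion H k α ⟨
    + kromaticCoeff H k α
      ∎
    where
    open ≡-Reasoning
    α = Vec.map toℕ β
    coefficient : ∀ W c → lookup (point H W) (lookup β c) ≡ indPolyInduced H W (lookup α c)
    coefficient W c = trans (lookup-point H W (lookup β c)) (cong (indPolyInduced H W) (sym (lookup-map c toℕ β)))

  massAt-weightedPoints : {m : ℕ} (H : SimpleGraph m) (y : Vec ℕ (2 ℕ.+ d)) →
    massAt (weightedPoints H) y ≡ -1^ (m ℕ.+ size y) * + multiplicity _≟ᵛ_ y (map (point H) (allSubsets m))
  massAt-weightedPoints {m} H y = begin
    massAt (weightedPoints H) y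
      ≡⟨ ∑-map _ (allSubsets m) _ ⟩
    ∑[ W ∈ allSubsets m ] (-1^ (m ℕ.+ ∣ W ∣) * 𝟙 (at W))
      ≡⟨ ∑-cong (allSubsets m) sign-from-point ⟩
    ∑[ W ∈ allSubsets m ] (-1^ (m ℕ.+ size y) * 𝟙 (at W))
      ≡⟨ ∑-*ˡ (allSubsets m) (-1^ (m ℕ.+ size y)) (𝟙 ∘ at) ⟩
    -1^ (m ℕ.+ size y) * ∑[ W ∈ allSubsets m ] 𝟙 (at W)
      ≡⟨ cong (-1^ (m ℕ.+ size y) *_) (∑-map (point H) (allSubsets m) _) ⟨
    -1^ (m ℕ.+ size y) * ∑[ x ∈ map (point H) (allSubsets m) ] 𝟙 ⌊ x ≟ᵛ y ⌋
      ≡⟨ cong (-1^ (m ℕ.+ size y) *_) (count≡∑𝟙 _ (map (point H) (allSubsets m))) ⟨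
    -1^ (m ℕ.+ size y) * + multiplicity _≟ᵛ_ y (map (point H) (allSubsets m))
      ∎
    where
    open ≡-Reasoning
    at : Subset m → Bool
    at W = ⌊ point H W ≟ᵛ y ⌋
    sign-from-point : ∀ W → -1^ (m ℕ.+ ∣ W ∣) * 𝟙 (at W) ≡ -1^ (m ℕ.+ size y) * 𝟙 (at W)
    sign-from-point W with point H W ≟ᵛ y
    ... | yes refl = cong (λ s → -1^ (m ℕ.+ s) * 1ℤ) (sym (size-point H W))
    ... | no _     = trans (ℤ.*-zeroʳ (-1^ (m ℕ.+ ∣ W ∣))) (sym (ℤ.*-zeroʳ (-1^ (m ℕ.+ size y))))

  same-point⇒same-indPolyInduced : {m m′ : ℕ} (H : SimpleGraph m) (H′ : SimpleGraph m′)
    {W : Subset m} {W′ : Subset m′} →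
    m ≤ suc d → m′ ≤ suc d → point H W ≡ point H′ W′ → ∀ k → indPolyInduced H W k ≡ indPolyInduced H′ W′ k
  same-point⇒same-indPolyInduced H H′ {W} {W′} m≤ m′≤ same k with k ℕ.<? 2 ℕ.+ d
  ... | yes k<D = begin
    indPolyInduced H W k                      ≡⟨ cong (indPolyInduced H W) (Fin.toℕ-fromℕ< k<D) ⟨
    indPolyInduced H W (toℕ (fromℕ< k<D))     ≡⟨ lookup-point H W (fromℕ< k<D) ⟨
    lookup (point H W) (fromℕ< k<D)           ≡⟨ cong (λ x → lookup x (fromℕ< k<D)) same ⟩
    lookup (point H′ W′) (fromℕ< k<D)         ≡⟨ lookup-point H′ W′ (fromℕ< k<D) ⟩
    indPolyInduced H′ W′ (toℕ (fromℕ< k<D))   ≡⟨ cong (indPolyInduced H′ W′) (Fin.toℕ-fromℕ< k<D) ⟩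
    indPolyInduced H′ W′ k                    ∎
    where open ≡-Reasoning
  ... | no k≮D = trans (indPolyInduced-vanishes H W (beyond m≤)) (sym (indPolyInduced-vanishes H′ W′ (beyond m′≤)))
    where
    beyond : ∀ {m} → m ≤ suc d → m < k
    beyond m≤ = ℕ.<-≤-trans (ℕ.s≤s m≤) (ℕ.≮⇒≥ k≮D)

module _ {n n′ : ℕ} (G : SimpleGraph n) (G′ : SimpleGraph n′) where

  private
    -- Coordinates 0 … n + n′ + 1 hold every coefficient that can be nonzero on either side.
    d = n ℕ.+ n′

  pointMultiplicity : {m : ℕ} → SimpleGraph m → Vec ℕ (2 ℕ.+ d) → ℕ
  pointMultiplicity {m} H y = multiplicity _≟ᵛ_ y (map (point d H) (allSubsets m))

  kromaticEq⇒signed-multiplicities : KromaticEq G G′ → ∀ y →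
    -1^ (n ℕ.+ size d y) * + pointMultiplicity G y ≡ -1^ (n′ ℕ.+ size d y) * + pointMultiplicity G′ y
  kromaticEq⇒signed-multiplicities same-coeffs y = ℤ.i-j≡0⇒i≡j _ _ (begin
    -1^ (n ℕ.+ size d y) * + pointMultiplicity G y - -1^ (n′ ℕ.+ size d y) * + pointMultiplicity G′ y
      ≡⟨ cong₂ _-_ (massAt-weightedPoints d G y) (massAt-weightedPoints d G′ y) ⟨
    massAt (weightedPoints d G) y - massAt (weightedPoints d G′) y
      ≡⟨ ∫-difference (weightedPoints d G) (weightedPoints d G′) (λ x → 𝟙 ⌊ x ≟ᵛ y ⌋) ⟨
    massAt μ y
      ≡⟨ moments-vanish⇒massAt-vanishes μ moments y ⟩
    0ℤ
      ∎)
    where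
    open ≡-Reasoning
    μ = weightedPoints d G ++ negate (weightedPoints d G′)
    moments : ∀ k (β : Vec (Fin (2 ℕ.+ d)) k) → ∫ μ (λ x → monomial x β) ≡ 0ℤ
    moments k β = trans (∫-difference (weightedPoints d G) (weightedPoints d G′) (λ x → monomial x β))
      (trans (cong₂ _-_ (∫-weightedPoints-monomial d G β) (∫-weightedPoints-monomial d G′ β))
             (ℤ.i≡j⇒i-j≡0 (cong +_ (same-coeffs k (Vec.map toℕ β)))))

  kromaticEq⇒same-multiplicities : KromaticEq G G′ → ∀ y → pointMultiplicity G y ≡ pointMultiplicity G′ y
  kromaticEq⇒same-multiplicities same-coeffs y =
    ℤ.+-injective (-1^-*-cancelʳ (+ c) (+ c′) (n′ ℕ.+ size d y) (begin
      + c * -1^ (n′ ℕ.+ size d y)  ≡⟨ ℤ.*-comm (+ c) _ ⟩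
      -1^ (n′ ℕ.+ size d y) * + c  ≡⟨ cong (_* + c) (same-signs (size d y)) ⟨
      -1^ (n ℕ.+ size d y) * + c   ≡⟨ signed y ⟩
      -1^ (n′ ℕ.+ size d y) * + c′ ≡⟨ ℤ.*-comm _ (+ c′) ⟩
      + c′ * -1^ (n′ ℕ.+ size d y) ∎))
    where
    open ≡-Reasoning
    c  = pointMultiplicity G y
    c′ = pointMultiplicity G′ y
    signed = kromaticEq⇒signed-multiplicities same-coeffs
    y₀ = point d G ⊥
    y₀-occurs : 1 ≤ pointMultiplicity G y₀
    y₀-occurs = ∈⇒multiplicity>0 _≟ᵛ_ (∈-map⁺ (point d G) (complete (allSubsets-isEnumeration n) ⊥))
    -- A point of positive multiplicity forces the signs to agree there, and hence everywhere.
    same-signs : ∀ m → -1^ (n ℕ.+ m) ≡ -1^ (n′ ℕ.+ m)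
    same-signs = -1^-+-cong n n′ (size d y₀)
      (-1^-*-same-sign (n ℕ.+ size d y₀) (n′ ℕ.+ size d y₀) (pointMultiplicity G y₀) (pointMultiplicity G′ y₀)
                       (signed y₀) y₀-occurs)

  kromaticEq⇒sameIndPolyMultiset : KromaticEq G G′ → SameIndPolyMultiset G G′
  kromaticEq⇒sameIndPolyMultiset same-coeffs = σ , λ W →
    same-point⇒same-indPolyInduced d G G′ {W} {Inverse.to σ W} n≤ n′≤ (same-point W)
    where
    points-↔ : Σ (Subset n ↔ Subset n′) λ σ → ∀ W → point d G W ≡ point d G′ (Inverse.to σ W)
    points-↔ = ↭-images⇒↔ (allSubsets-isEnumeration n) (allSubsets-isEnumeration n′) (point d G) (point d G′)
      (same-multiplicities⇒↭ _≟ᵛ_ (map (point d G) (allSubsets n)) (map (point d G′) (allSubsets n′))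
                                  (kromaticEq⇒same-multiplicities same-coeffs))
    σ : Subset n ↔ Subset n′
    σ = proj₁ points-↔
    same-point : ∀ W → point d G W ≡ point d G′ (Inverse.to σ W)
    same-point = proj₂ points-↔
    n≤ : n ≤ suc d
    n≤ = ℕ.m≤n⇒m≤1+n (ℕ.m≤m+n n n′)
    n′≤ : n′ ≤ suc d
    n′≤ = ℕ.m≤n⇒m≤1+n (ℕ.m≤n+m n′ n)

corollary1p6 : {n n' : ℕ} (G : SimpleGraph n) (G' : SimpleGraph n') →
    KromaticEq G G' ⇔ SameIndPolyMultiset G G'
corollary1p6 G G' = mk⇔ (kromaticEq⇒sameIndPolyMultiset G G') (sameIndPolyMultiset⇒kromaticEq G G')
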